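{- Fix a code retrieving function $\rho$ (all triples below are w.r.t. $\rho$). Assume (1) $R(P)\subseteq P$, (2) for every state $\sigma$: $\models\{\emptyset,\ P\cap C\cap\{\sigma\}\}\,p\,\{\{\sigma'\mid\sigma'\in Q\wedge(\sigma,\sigma')\in G\},\ \alpha\times\alpha\}$. Then $\models\{R,P\}\,\mathbf{await}\,C\,p\,\{Q,G\}$.
   Context: Program terms over a state type $\alpha$ are generated by $p::=\mathbf{skip}\mid\mathbf{basic}\,f\mid\mathbf{cjump}\,C\,i\,p\mid\mathbf{while}\,C\,p\,p\mid\mathbf{if}\,C\,p\,p\mid p;p\mid\Vert(p_1,\dots,p_m)\mid\mathbf{await}\,C\,p$ ($f:\alpha\to\alpha$, $C\subseteq\alpha$, $i\in\mathbb N$, $m\ge1$). A code retrieving function $\rho$ maps $\mathbb N$ to terms. The program step relation $\rho\vdash(p,\sigma)\to_{\mathcal P}(p',\sigma')$ is the least relation with: $(\mathbf{basic}\,f,\sigma)\to(\mathbf{skip},f\sigma)$; $(\mathbf{cjump}\,C\,i\,p,\sigma)\to(\rho\,i,\sigma)$ if $\sigma\in C$, $\to(p,\sigma)$ otherwise; $(\mathbf{await}\,C\,p,\sigma)\to(\mathbf{skip},\sigma')$ if $\sigma\in C$ and $(p,\sigma)\to^*(\mathbf{skip},\sigma')$ (reflexive-transitive closure of program steps); $(\mathbf{if}\,C\,p_1\,p_2,\sigma)\to(p_1,\sigma)$ if $\sigma\in C$, $\to(p_2,\sigma)$ otherwise; for $x=\mathbf{while}\,C\,p_1\,p_2$: $(x,\sigma)\to(p_1;(\mathbf{skip};x),\sigma)$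 if $\sigma\in C$, $\to(p_2,\sigma)$ otherwise; $(p_1;p_2,\sigma)\to(p_1';p_2,\sigma')$ if $(p_1,\sigma)\to(p_1',\sigma')$; $(\mathbf{skip};p,\sigma)\to(p,\sigma)$; $(\Vert(\dots,p_i,\dots),\sigma)\to(\Vert(\dots,p_i',\dots),\sigma')$ if $(p_i,\sigma)\to(p_i',\sigma')$; $(\Vert(\mathbf{skip},\dots,\mathbf{skip}),\sigma)\to(\mathbf{skip},\sigma)$. A finite potential computation of $(\rho,p)$ is a nonempty finite sequence $(p_0,\sigma_0),\dots,(p_{n-1},\sigma_{n-1})$ with $p_0=p$ where each transition is a program step or an environment step ($p_{i+1}=p_i$, state arbitrary). For state relations $R,G\subseteq\alpha\times\alpha$ and state predicates $P,Q\subseteq\alpha$, $\models\{R,P\}\,p\,\{Q,G\}$ means: every finite potential computation of $(\rho,p)$ with $\sigma_0\in P$ and $(\sigma_i,\sigma_{i+1})\in R$ for all environment steps has $(\sigma_i,\sigma_{i+1})\in G$ for all program steps and, if some $p_i=\mathbf{skip}$, $\sigma_i\in Q$ for the least such $i$. $R(X)=\{b\mid\exists a\in X.(a,b)\in R\}$. -}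

module Defs where

open import Data.Nat using (ℕ; suc; _<_; _≤_)
open import Data.Fin using (Fin)
open import Data.Vec using (Vec; lookup; _[_]≔_)
open import Data.Vec.Relation.Unary.All using (All)
open import Data.Product using (_×_; _,_; proj₁; proj₂)
open import Data.Unit using (⊤)
open import Relation.Nullary using (¬_)
open import Relation.Binary.PropositionalEquality using (_≡_)

data Prog (α : Set) : Set₁ where
  skip  : Prog α
  basic : (α → α) → Prog α
  cjump : (α → Set) → ℕ → Prog α → Prog α
  while : (α → Set) → Prog α → Prog α → Prog α
  if    : (α → Set) → Prog α → Prog α → Prog α
  _⨾_   : Prog α → Prog α → Prog α
  par   : {m : ℕ} → Vec (Prog α) (suc m) → Prog α
  await : (α → Set) → Prog α → Prog α

mutual
  data Step {α : Set} (ρ : ℕ → Prog α) : Prog α → α → Prog α → α → Set₁ where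
    basic-step : ∀ {f σ} → Step ρ (basic f) σ skip (f σ)
    cjump-true : ∀ {C i p σ} → C σ → Step ρ (cjump C i p) σ (ρ i) σ
    cjump-false : ∀ {C i p σ} → ¬ C σ → Step ρ (cjump C i p) σ p σ
    await-step : ∀ {C p σ σ'} → C σ → Steps ρ p σ skip σ' → Step ρ (await C p) σ skip σ'
    if-true : ∀ {C p₁ p₂ σ} → C σ → Step ρ (if C p₁ p₂) σ p₁ σ
    if-false : ∀ {C p₁ p₂ σ} → ¬ C σ → Step ρ (if C p₁ p₂) σ p₂ σ
    while-true : ∀ {C p₁ p₂ σ} → C σ →
      Step ρ (while C p₁ p₂) σ (p₁ ⨾ (skip ⨾ while C p₁ p₂)) σ
    while-false : ∀ {C p₁ p₂ σ} → ¬ C σ → Step ρ (while C p₁ p₂) σ p₂ σ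
    seq-step : ∀ {p₁ p₁' p₂ σ σ'} → Step ρ p₁ σ p₁' σ' → Step ρ (p₁ ⨾ p₂) σ (p₁' ⨾ p₂) σ'
    seq-skip : ∀ {p σ} → Step ρ (skip ⨾ p) σ p σ
    par-step : ∀ {m} {ps : Vec (Prog α) (suc m)} {p' σ σ'} (i : Fin (suc m)) →
      Step ρ (lookup ps i) σ p' σ' → Step ρ (par ps) σ (par (ps [ i ]≔ p')) σ'
    par-skip : ∀ {m} {ps : Vec (Prog α) (suc m)} {σ} →
      All (_≡ skip) ps → Step ρ (par ps) σ skip σ

  data Steps {α : Set} (ρ : ℕ → Prog α) : Prog α → α → Prog α → α → Set₁ where
    refl* : ∀ {p σ} → Steps ρ p σ p σ
    step* : ∀ {p σ p' σ' p'' σ''} → Step ρ p σ p' σ' → Steps ρ p' σ' p'' σ'' →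
      Steps ρ p σ p'' σ''

Config : Set → Set₁
Config α = Prog α × α

data Trans {α : Set} (ρ : ℕ → Prog α) : Config α → Config α → Set₁ where
  env  : ∀ {p σ σ'} → Trans ρ (p , σ) (p , σ')
  prog : ∀ {p σ p' σ'} → Step ρ p σ p' σ' → Trans ρ (p , σ) (p' , σ')

record PotComp {α : Set} (ρ : ℕ → Prog α) (p : Prog α) : Set₁ where
  field
    len   : ℕ
    cfg   : ℕ → Config α          -- only indices 0..len are relevant
    start : proj₁ (cfg 0) ≡ p
    trans : (i : ℕ) → i < len → Trans ρ (cfg i) (cfg (suc i))

envOK : {α : Set} {ρ : ℕ → Prog α} {c c' : Config α} →
        (α → α → Set) → Trans ρ c c' → Set
envOK R (env {σ = σ} {σ' = σ'}) = R σ σ'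
envOK R (prog _) = ⊤

progOK : {α : Set} {ρ : ℕ → Prog α} {c c' : Config α} →
         (α → α → Set) → Trans ρ c c' → Set
progOK G env = ⊤
progOK G (prog {σ = σ} {σ' = σ'} _) = G σ σ'

Valid : {α : Set} (ρ : ℕ → Prog α) (R : α → α → Set) (P : α → Set)
        (p : Prog α) (Q : α → Set) (G : α → α → Set) → Set₁
Valid {α} ρ R P p Q G =
  (c : PotComp ρ p) →
  let open PotComp c in
  P (proj₂ (cfg 0)) →
  ((i : ℕ) (lt : i < len) → envOK R (trans i lt)) →
  ((i : ℕ) (lt : i < len) → progOK G (trans i lt))
  × ((i : ℕ) → i ≤ len → proj₁ (cfg i) ≡ skip →
       ((j : ℕ) → j < i → ¬ (proj₁ (cfg j) ≡ skip)) →
       Q (proj₂ (cfg i)))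

module Submission where

-- A potential computation of  await C p  started in P can only do two
-- things before it reaches skip: environment steps, which keep the state in P
-- because R(P) ⊆ P, and one atomic program step  (await C p, σ) → (skip, σ')
-- with σ ∈ C and  p  running to skip from σ in isolation.  After that step the
-- program is skip, which has no further program steps.

open import Defs
open import Data.Nat using (ℕ; zero; suc; _<_; _≤_; s≤s)
open import Data.Nat.Properties using (≤-refl; <⇒≤)
open import Data.Product using (_×_; _,_; proj₁; proj₂)
open import Data.Sum using (_⊎_; inj₁; inj₂)
open import Data.Unit using (⊤; tt)
open import Data.Empty using (⊥; ⊥-elim)
open import Relation.Nullary using (¬_)
open import Relation.Binary.PropositionalEquality using (_≡_; refl; sym; cong; subst)

skip-final : ∀ {α} {ρ : ℕ → Prog α} {σ q σ'} → ¬ Step ρ skip σ q σ'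
skip-final ()

await≢skip : ∀ {α} {C : α → Set} {p : Prog α} → ¬ (await C p ≡ skip)
await≢skip ()

module IsolatedRun {α : Set} (ρ : ℕ → Prog α) where

  runLength : ∀ {p σ q σ'} → Steps ρ p σ q σ' → ℕ
  runLength refl*        = 0
  runLength (step* _ ss) = suc (runLength ss)

  -- The i-th configuration of the run; it stays at the final one beyond the end.
  runConfig : ∀ {p σ q σ'} → Steps ρ p σ q σ' → ℕ → Config α
  runConfig {p} {σ} refl*        _       = p , σ
  runConfig {p} {σ} (step* _ _)  zero    = p , σ
  runConfig         (step* _ ss) (suc i) = runConfig ss i

  runConfig-start : ∀ {p σ q σ'} (ss : Steps ρ p σ q σ') → runConfig ss 0 ≡ (p , σ)
  runConfig-start refl*       = refl
  runConfig-start (step* _ _) = refl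

  runConfig-end : ∀ {p σ q σ'} (ss : Steps ρ p σ q σ') →
                  runConfig ss (runLength ss) ≡ (q , σ')
  runConfig-end refl*        = refl
  runConfig-end (step* _ ss) = runConfig-end ss

  runTrans : ∀ {p σ q σ'} (ss : Steps ρ p σ q σ') (i : ℕ) → i < runLength ss →
             Trans ρ (runConfig ss i) (runConfig ss (suc i))
  runTrans (step* _ ss)          (suc i) (s≤s i<n) = runTrans ss i i<n
  runTrans (step* s refl*)       zero    _         = prog s
  runTrans (step* s (step* _ _)) zero    _         = prog s

  runTrans-envOK : ∀ {p σ q σ'} (ss : Steps ρ p σ q σ') (i : ℕ) (i<n : i < runLength ss) →
                   envOK (λ _ _ → ⊥) (runTrans ss i i<n)
  runTrans-envOK (step* _ ss)          (suc i) (s≤s i<n) = runTrans-envOK ss i i<n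
  runTrans-envOK (step* _ refl*)       zero    _         = tt
  runTrans-envOK (step* _ (step* _ _)) zero    _         = tt

  -- A configuration that still makes a program step is not terminated.
  runConfig-notSkip : ∀ {p σ q σ'} (ss : Steps ρ p σ q σ') (j : ℕ) → j < runLength ss →
                      ¬ (proj₁ (runConfig ss j) ≡ skip)
  runConfig-notSkip (step* s _)  zero    _         refl = skip-final s
  runConfig-notSkip (step* _ ss) (suc j) (s≤s j<n)      = runConfig-notSkip ss j j<n

  runComputation : ∀ {p σ q σ'} → Steps ρ p σ q σ' → PotComp ρ p
  runComputation ss = record
    { len   = runLength ss
    ; cfg   = runConfig ss
    ; start = cong proj₁ (runConfig-start ss)
    ; trans = runTrans ss
    }

  -- A triple valid under the empty rely establishes its postcondition at the
  -- end of every isolated run to skip; this is what the await step executes.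
  runPost : ∀ {P Q : α → Set} {G : α → α → Set} {p σ σ'} →
            Valid ρ (λ _ _ → ⊥) P p Q G → P σ → Steps ρ p σ skip σ' → Q σ'
  runPost {P} {Q} valid Pσ ss =
    subst (λ c → Q (proj₂ c)) (runConfig-end ss)
      (proj₂ (valid (runComputation ss) Pσ₀ (runTrans-envOK ss))
             (runLength ss) ≤-refl (cong proj₁ (runConfig-end ss))
             (runConfig-notSkip ss))
    where
    Pσ₀ : P (proj₂ (runConfig ss 0))
    Pσ₀ = subst (λ c → P (proj₂ c)) (sym (runConfig-start ss)) Pσ

open IsolatedRun using (runPost)

AwaitInv : ∀ {α} (P C : α → Set) (p : Prog α) → Config α → Set₁
AwaitInv P C p (q , σ) = (q ≡ await C p × P σ) ⊎ q ≡ skip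

awaitInv-step : ∀ {α} {ρ : ℕ → Prog α} {R : α → α → Set} {P C : α → Set} {p x y} →
                (∀ a b → P a → R a b → P b) →
                AwaitInv P C p x → (t : Trans ρ x y) → envOK R t → AwaitInv P C p y
awaitInv-step stable (inj₁ (refl , Pσ)) env                  Rσσ' = inj₁ (refl , stable _ _ Pσ Rσσ')
awaitInv-step stable (inj₁ (refl , _))  (prog (await-step _ _)) _ = inj₂ refl
awaitInv-step stable (inj₂ refl)        env                  _    = inj₂ refl
awaitInv-step stable (inj₂ refl)        (prog s)             _    = ⊥-elim (skip-final s)

AwaitEffect : ∀ {α} (ρ : ℕ → Prog α) (P Q C : α → Set) (G : α → α → Set) (p : Prog α) → Set₁
AwaitEffect ρ P Q C G p = ∀ {σ σ'} → C σ → P σ → Steps ρ p σ skip σ' → Q σ' × G σ σ'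

awaitInv-guarantee : ∀ {α} {ρ : ℕ → Prog α} {G : α → α → Set} {P Q C : α → Set} {p x y} →
                     AwaitEffect ρ P Q C G p →
                     AwaitInv P C p x → (t : Trans ρ x y) → progOK G t
awaitInv-guarantee effect _                  env                       = tt
awaitInv-guarantee effect (inj₁ (refl , Pσ)) (prog (await-step Cσ ss)) = proj₂ (effect Cσ Pσ ss)
awaitInv-guarantee effect (inj₂ refl)        (prog s)                  = ⊥-elim (skip-final s)

awaitInv-post : ∀ {α} {ρ : ℕ → Prog α} {G : α → α → Set} {P Q C : α → Set} {p x y} →
                AwaitEffect ρ P Q C G p →
                AwaitInv P C p x → ¬ (proj₁ x ≡ skip) →
                (t : Trans ρ x y) → proj₁ y ≡ skip → Q (proj₂ y)
awaitInv-post effect (inj₁ (refl , _))  _      env ()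
awaitInv-post effect (inj₁ (refl , Pσ)) _      (prog (await-step Cσ ss)) _ = proj₁ (effect Cσ Pσ ss)
awaitInv-post effect (inj₂ q≡skip)      q≢skip _ _ = ⊥-elim (q≢skip q≡skip)

mainTheorem5 : {α : Set} (ρ : ℕ → Prog α) (R G : α → α → Set) (P Q C : α → Set)
    (p : Prog α) →
    (∀ a b → P a → R a b → P b) →
    (∀ σ → Valid ρ (λ _ _ → ⊥) (λ s → P s × C s × s ≡ σ) p
    (λ s' → Q s' × G σ s') (λ _ _ → ⊤)) →
    Valid ρ R P (await C p) Q G
mainTheorem5 ρ R G P Q C p stable body c Pσ₀ relied = guarantee , postcondition
  where
  open PotComp c

  effect : AwaitEffect ρ P Q C G p
  effect {σ} Cσ Pσ ss = runPost ρ {P = λ s → P s × C s × s ≡ σ} (body σ) (Pσ , Cσ , refl) ss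

  invariant : (i : ℕ) → i ≤ len → AwaitInv P C p (cfg i)
  invariant zero    _   = inj₁ (start , Pσ₀)
  invariant (suc i) i<n = awaitInv-step stable (invariant i (<⇒≤ i<n)) (trans i i<n) (relied i i<n)

  guarantee : (i : ℕ) (i<n : i < len) → progOK G (trans i i<n)
  guarantee i i<n = awaitInv-guarantee effect (invariant i (<⇒≤ i<n)) (trans i i<n)

  postcondition : (i : ℕ) → i ≤ len → proj₁ (cfg i) ≡ skip →
                  ((j : ℕ) → j < i → ¬ (proj₁ (cfg j) ≡ skip)) → Q (proj₂ (cfg i))
  postcondition zero    _   cfg₀≡skip _ = ⊥-elim (await≢skip (subst (_≡ skip) start cfg₀≡skip))
  postcondition (suc i) i<n cfg≡skip earlier =
    awaitInv-post effect (invariant i (<⇒≤ i<n)) (earlier i ≤-refl) (trans i i<n) cfg≡skip
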